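{- Let $G$ and $H$ be connected non complete graphs and consider the corona product graph $G\circ H$. Let $i,j\in\{1,\ldots,n\}$ be distinct and $k,l\in\{1,\ldots,m\}$. Then $$WT_{G\circ H}(h_k^i,h_l^j)=V(G\circ H)\setminus\big(N_{H^i}(h_k^i)\cup N_{H^j}(h_l^j)\big).$$
   Context: All graphs are finite, simple, connected and have at least two vertices. For vertices $u,v$ of a graph $G$, a weakly toll walk between $u$ and $v$ is a sequence $u=w_0,w_1,\ldots,w_k=v$ ($k\ge 0$) such that, when $k>0$: $w_iw_{i+1}\in E(G)$ for all $i\in\{0,\ldots,k-1\}$; $uw_i\in E(G)$ with $i\in\{1,\ldots,k\}$ implies $w_i=w_1$; and $w_iv\in E(G)$ with $i\in\{0,\ldots,k-1\}$ implies $w_i=w_{k-1}$. $WT_G(u,v)$ is the set of vertices lying on some weakly toll walk between $u$ and $v$. Let $V(G)=\{g_1,\ldots,g_n\}$ and $V(H)=\{h_1,\ldots,h_m\}$. The corona product $G\circ H$ consists of $G$ together with $n$ disjoint copies $H^1,\ldots,H^n$ of $H$, $V(H^i)=\{h_1^i,\ldots,h_m^i\}$, with additional edges $g_ih_j^i$ for all $i,j$. $N_{H^i}(x)$ denotes the open neighbourhood of $x$ within $H^i$. -}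

module Defs where

open import Data.Nat using (ℕ; zero; suc; _≤_; _<_; _∸_)
open import Data.Fin using (Fin)
open import Data.Product using (Σ; _×_; _,_; ∃; ∃-syntax)
open import Data.Sum using (_⊎_; inj₁; inj₂)
open import Relation.Nullary using (¬_)
open import Relation.Binary.PropositionalEquality using (_≡_; _≢_; refl; sym)

record Graph (V : Set) : Set₁ where
  field
    Adj    : V → V → Set
    symAdj : ∀ {u v} → Adj u v → Adj v u
    irrefl : ∀ {u} → ¬ Adj u u
open Graph public

-- A walk u = w 0, w 1, …, w k = v (values of w beyond k are irrelevant).
record IsWalk {V : Set} (G : Graph V) (u v : V) (k : ℕ) (w : ℕ → V) : Set where
  field
    start : w 0 ≡ u
    end   : w k ≡ v
    steps : ∀ i → i < k → Adj G (w i) (w (suc i))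

record IsWeaklyTollWalk {V : Set} (G : Graph V) (u v : V) (k : ℕ) (w : ℕ → V) : Set where
  field
    walk  : IsWalk G u v k w
    tollU : 0 < k → ∀ i → 1 ≤ i → i ≤ k → Adj G u (w i) → w i ≡ w 1
    tollV : 0 < k → ∀ i → i < k → Adj G (w i) v → w i ≡ w (k ∸ 1)

WT : {V : Set} → Graph V → V → V → V → Set
WT {V} G u v x = Σ ℕ λ k → Σ (ℕ → V) λ w →
  IsWeaklyTollWalk G u v k w × (Σ ℕ λ i → i ≤ k × w i ≡ x)

Connected : {V : Set} → Graph V → Set
Connected G = ∀ u v → Σ ℕ λ k → Σ (ℕ → _) λ w → IsWalk G u v k w

NonComplete : {V : Set} → Graph V → Set
NonComplete G = Σ _ λ u → Σ _ λ v → u ≢ v × ¬ Adj G u v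

-- Corona product G ∘ H: vertex inj₁ a is g_a, vertex inj₂ (i , k) is h_k^i.
CVertex : ℕ → ℕ → Set
CVertex n m = Fin n ⊎ (Fin n × Fin m)

coronaAdj : ∀ {n m} → Graph (Fin n) → Graph (Fin m) → CVertex n m → CVertex n m → Set
coronaAdj G H (inj₁ a) (inj₁ b) = Adj G a b
coronaAdj G H (inj₁ a) (inj₂ (i , k)) = a ≡ i
coronaAdj G H (inj₂ (i , k)) (inj₁ a) = i ≡ a
coronaAdj G H (inj₂ (i , k)) (inj₂ (j , l)) = i ≡ j × Adj H k l

coronaSym : ∀ {n m} (G : Graph (Fin n)) (H : Graph (Fin m)) {x y} →
  coronaAdj G H x y → coronaAdj G H y x
coronaSym G H {inj₁ a} {inj₁ b} e = symAdj G e
coronaSym G H {inj₁ a} {inj₂ _} e = sym e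
coronaSym G H {inj₂ _} {inj₁ a} e = sym e
coronaSym G H {inj₂ _} {inj₂ _} (e , h) = sym e , symAdj H h

coronaIrrefl : ∀ {n m} (G : Graph (Fin n)) (H : Graph (Fin m)) {x} →
  ¬ coronaAdj G H x x
coronaIrrefl G H {inj₁ a} e = irrefl G e
coronaIrrefl G H {inj₂ _} (_ , h) = irrefl H h

corona : ∀ {n m} → Graph (Fin n) → Graph (Fin m) → Graph (CVertex n m)
corona G H = record
  { Adj = coronaAdj G H
  ; symAdj = λ {x} {y} → coronaSym G H {x} {y}
  ; irrefl = λ {x} → coronaIrrefl G H {x} }

InNH : ∀ {n m} → Graph (Fin m) → Fin n → Fin m → CVertex n m → Set
InNH H i k x = Σ _ λ l → x ≡ inj₂ (i , l) × Adj H k l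

-- A weakly toll walk from h_k^i must leave the copy H^i, and the only way out is g_i;
-- as g_i is adjacent to h_k^i, the toll condition forces w 1 = g_i, so no neighbour of
-- h_k^i in H^i can occur on the walk.  Symmetrically the walk enters H^j only through
-- g_j = w (K ∸ 1), K the length of the walk.  Conversely, any other vertex x is
-- visited by the walk h_k^i, g_i, (path in G to the anchor of x), x, back, (path in G to g_j), h_l^j,
-- whose only vertices adjacent to the endpoints are g_i and g_j.
module Submission where

open import Defs
open import Data.Nat using (ℕ; zero; suc; _+_; _∸_; _≤_; _<_; z≤n; s≤s)
open import Data.Nat.Properties
  using (≤-refl; ≤-trans; <⇒≤; m<n⇒m<1+n; m≤n⇒m<n∨m≡n; m+n∸n≡m)
open import Data.Fin using (Fin; _≟_)
open import Data.Product using (_×_; _,_; proj₁; proj₂; ∃-syntax)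
open import Data.Sum using (_⊎_; inj₁; inj₂)
open import Data.Empty using (⊥-elim)
open import Function using (_∘_)
open import Function.Bundles using (_⇔_; mk⇔)
open import Relation.Nullary using (¬_; yes; no; ¬?)
open import Relation.Nullary.Decidable using (decidable-stable)
open import Relation.Unary using (Decidable)
open import Relation.Binary.PropositionalEquality
  using (_≡_; _≢_; refl; sym; trans; cong; subst; module ≡-Reasoning)

crossing : (P : ℕ → Set) → Decidable P → ∀ K → P 0 → ¬ P K →
           ∃[ t ] t < K × P t × ¬ P (suc t)
crossing P P? zero p₀ ¬p₀ = ⊥-elim (¬p₀ p₀)
crossing P P? (suc K) p₀ ¬pK+1 with P? K
... | yes pK = K , ≤-refl , pK , ¬pK+1
... | no ¬pK with crossing P P? K p₀ ¬pK
...   | t , t<K , pt , ¬pt+1 = t , m<n⇒m<1+n t<K , pt , ¬pt+1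

module _ {V : Set} (G : Graph V) where

  isWalk-head : ∀ {a b K w} → IsWalk G a b (suc K) w → Adj G a (w 1)
  isWalk-head W = subst (λ c → Adj G c _) (IsWalk.start W) (IsWalk.steps W 0 (s≤s z≤n))

  isWalk-tail : ∀ {a b K w} → IsWalk G a b (suc K) w → IsWalk G (w 1) b K (w ∘ suc)
  isWalk-tail W = record
    { start = refl
    ; end   = IsWalk.end W
    ; steps = λ t t<K → IsWalk.steps W (suc t) (s≤s t<K) }

  module _ {u v : V} {K : ℕ} {w : ℕ → V} (tw : IsWeaklyTollWalk G u v K w) where
    open IsWeaklyTollWalk tw
    open IsWalk walk

    toll-neighbourˡ : ∀ {s} → s ≤ K → Adj G u (w s) → w s ≡ w 1
    toll-neighbourˡ {zero} _ u~w₀ = ⊥-elim (irrefl G (subst (Adj G u) start u~w₀))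
    toll-neighbourˡ {suc s} s<K u~ws = tollU (≤-trans (s≤s z≤n) s<K) (suc s) (s≤s z≤n) s<K u~ws

    toll-neighbourʳ : ∀ {s} → s ≤ K → Adj G (w s) v → w s ≡ w (K ∸ 1)
    toll-neighbourʳ s≤K ws~v with m≤n⇒m<n∨m≡n s≤K
    ... | inj₁ s<K  = tollV (≤-trans (s≤s z≤n) s<K) _ s<K ws~v
    ... | inj₂ refl = ⊥-elim (irrefl G (subst (λ c → Adj G c v) end ws~v))

module Walks {V : Set} (G : Graph V) (P : V → Set) where

  infixr 5 _∷⟨_⟩_ _++_

  data Walk : V → V → Set where
    [_]    : ∀ {a} → P a → Walk a a
    _∷⟨_⟩_ : ∀ {a b c} → P a → Adj G a b → Walk b c → Walk a c

  length : ∀ {a b} → Walk a b → ℕ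
  length [ _ ]        = 0
  length (_ ∷⟨ _ ⟩ p) = suc (length p)

  at : ∀ {a b} → Walk a b → ℕ → V
  at ([_] {a} _)            _       = a
  at (_∷⟨_⟩_ {a} _ _ _) zero    = a
  at (_ ∷⟨ _ ⟩ p)           (suc t) = at p t

  at-0 : ∀ {a b} (p : Walk a b) → at p 0 ≡ a
  at-0 [ _ ]        = refl
  at-0 (_ ∷⟨ _ ⟩ _) = refl

  at-length : ∀ {a b} (p : Walk a b) → at p (length p) ≡ b
  at-length [ _ ]        = refl
  at-length (_ ∷⟨ _ ⟩ p) = at-length p

  at-adj : ∀ {a b} (p : Walk a b) t → t < length p → Adj G (at p t) (at p (suc t))
  at-adj (_ ∷⟨ a~b ⟩ p) zero    _         = subst (Adj G _) (sym (at-0 p)) a~b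
  at-adj (_ ∷⟨ _ ⟩ p)   (suc t) (s≤s t<n) = at-adj p t t<n

  at-P : ∀ {a b} (p : Walk a b) t → P (at p t)
  at-P [ pa ]        _       = pa
  at-P (pa ∷⟨ _ ⟩ _) zero    = pa
  at-P (_ ∷⟨ _ ⟩ p)  (suc t) = at-P p t

  end-P : ∀ {a b} → Walk a b → P b
  end-P [ pb ]       = pb
  end-P (_ ∷⟨ _ ⟩ p) = end-P p

  isWalk : ∀ {a b} (p : Walk a b) → IsWalk G a b (length p) (at p)
  isWalk p = record { start = at-0 p ; end = at-length p ; steps = at-adj p }

  _++_ : ∀ {a b c} → Walk a b → Walk b c → Walk a c
  [ _ ]         ++ q = q
  (pa ∷⟨ e ⟩ p) ++ q = pa ∷⟨ e ⟩ (p ++ q)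

  length-++ : ∀ {a b c} (p : Walk a b) (q : Walk b c) → length (p ++ q) ≡ length p + length q
  length-++ [ _ ]        q = refl
  length-++ (_ ∷⟨ _ ⟩ p) q = cong suc (length-++ p q)

  at-++-length : ∀ {a b c} (p : Walk a b) (q : Walk b c) → at (p ++ q) (length p) ≡ b
  at-++-length [ _ ]        q = at-0 q
  at-++-length (_ ∷⟨ _ ⟩ p) q = at-++-length p q

  Visits : ∀ {a b} → Walk a b → V → Set
  Visits p x = ∃[ t ] t ≤ length p × at p t ≡ x

  visits-∷ : ∀ {a b c x} {pa : P a} {e : Adj G a b} (p : Walk b c) →
             Visits p x → Visits (pa ∷⟨ e ⟩ p) x
  visits-∷ p (t , t≤n , at≡x) = suc t , s≤s t≤n , at≡x

  visits-++ˡ : ∀ {a b c x} (p : Walk a b) (q : Walk b c) → Visits p x → Visits (p ++ q) x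
  visits-++ˡ [ _ ]        q (zero , _ , refl)        = 0 , z≤n , at-0 q
  visits-++ˡ (_ ∷⟨ _ ⟩ p) q (zero , _ , at≡x)        = 0 , z≤n , at≡x
  visits-++ˡ (_ ∷⟨ _ ⟩ p) q (suc t , s≤s t≤n , at≡x) =
    visits-∷ (p ++ q) (visits-++ˡ p q (t , t≤n , at≡x))

  visits-++ʳ : ∀ {a b c x} (p : Walk a b) (q : Walk b c) → Visits q x → Visits (p ++ q) x
  visits-++ʳ [ _ ]        q v = v
  visits-++ʳ (_ ∷⟨ _ ⟩ p) q v = visits-∷ (p ++ q) (visits-++ʳ p q v)

  map-isWalk : ∀ {V₀ : Set} (G₀ : Graph V₀) (h : V₀ → V) →
               (∀ {a b} → Adj G₀ a b → Adj G (h a) (h b)) → (∀ a → P (h a)) →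
               ∀ K {a b w} → IsWalk G₀ a b K w → Walk (h a) (h b)
  map-isWalk G₀ h h-adj h-P zero {a} W =
    subst (λ c → Walk (h a) (h c)) (trans (sym (IsWalk.start W)) (IsWalk.end W)) [ h-P a ]
  map-isWalk G₀ h h-adj h-P (suc K) W =
    h-P _ ∷⟨ h-adj (isWalk-head G₀ W) ⟩ map-isWalk G₀ h h-adj h-P K (isWalk-tail G₀ W)

  module Enclose {u a b v : V}
           (only-aˡ : ∀ {y} → P y → Adj G u y → y ≡ a)
           (only-bʳ : ∀ {y} → P y → Adj G y v → y ≡ b)
           (pu : P u) (u~a : Adj G u a) (X : Walk a b) (b~v : Adj G b v) (pv : P v) where

    private
      prefix : Walk u b
      prefix = pu ∷⟨ u~a ⟩ X

      suffix : Walk b v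
      suffix = end-P X ∷⟨ b~v ⟩ [ pv ]

    enclose : Walk u v
    enclose = prefix ++ suffix

    enclose-penultimate : at enclose (length enclose ∸ 1) ≡ b
    enclose-penultimate = begin
      at enclose (length enclose ∸ 1)     ≡⟨ cong (λ s → at enclose (s ∸ 1)) (length-++ prefix suffix) ⟩
      at enclose (length prefix + 1 ∸ 1)  ≡⟨ cong (at enclose) (m+n∸n≡m (length prefix) 1) ⟩
      at enclose (length prefix)          ≡⟨ at-++-length prefix suffix ⟩
      b                                   ∎
      where open ≡-Reasoning

    enclose-weaklyToll : IsWeaklyTollWalk G u v (length enclose) (at enclose)
    enclose-weaklyToll = record
      { walk  = isWalk enclose
      ; tollU = λ _ t _ _ u~wt → trans (only-aˡ (at-P enclose t) u~wt) (sym (at-0 (X ++ suffix)))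
      ; tollV = λ _ t _ wt~v → trans (only-bʳ (at-P enclose t) wt~v) (sym enclose-penultimate) }

    enclose-visits : ∀ {x} → Visits X x → Visits enclose x
    enclose-visits h = visits-∷ (X ++ suffix) (visits-++ˡ X suffix h)

module Corona {n m : ℕ} (G : Graph (Fin n)) (H : Graph (Fin m)) where

  C : Graph (CVertex n m)
  C = corona G H

  anchor : CVertex n m → Fin n
  anchor (inj₁ c)       = c
  anchor (inj₂ (c , _)) = c

  InCopy : Fin n → CVertex n m → Set
  InCopy c y = ∃[ a ] y ≡ inj₂ (c , a)

  inCopy? : ∀ c → Decidable (InCopy c)
  inCopy? c (inj₁ _) = no λ ()
  inCopy? c (inj₂ (b , a)) with b ≟ c
  ... | yes refl = yes (a , refl)
  ... | no b≢c   = no λ { (_ , refl) → b≢c refl }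

  exit-copy : ∀ {c : Fin n} {x y : CVertex n m} →
              InCopy c x → ¬ InCopy c y → Adj C x y → y ≡ inj₁ c
  exit-copy {y = inj₁ _}       (_ , refl) _       c≡b      = cong inj₁ (sym c≡b)
  exit-copy {y = inj₂ (_ , a)} (_ , refl) y∉copy (refl , _) = ⊥-elim (y∉copy (a , refl))

  enter-copy : ∀ {c : Fin n} {x y : CVertex n m} →
               ¬ InCopy c x → InCopy c y → Adj C x y → x ≡ inj₁ c
  enter-copy {x = x} {y} x∉copy y∈copy x~y = exit-copy y∈copy x∉copy (symAdj C {x} {y} x~y)

  neighbour-adj : ∀ {c : Fin n} {k : Fin m} {x : CVertex n m} → InNH H c k x → Adj C (inj₂ (c , k)) x
  neighbour-adj (_ , refl , k~a) = refl , k~a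

  neighbour≢anchor : ∀ {c c′ : Fin n} {k : Fin m} {x : CVertex n m} →
                     InNH H c k x → x ≢ inj₁ c′
  neighbour≢anchor (_ , refl , _) ()

  module _ {i : Fin n} {k : Fin m} {y : CVertex n m} {K : ℕ} {w : ℕ → CVertex n m}
           (tw : IsWeaklyTollWalk C (inj₂ (i , k)) y K w) (y∉Hⁱ : ¬ InCopy i y) where
    open IsWalk (IsWeaklyTollWalk.walk tw)

    leaves-via-anchor : w 1 ≡ inj₁ i
    leaves-via-anchor with crossing (InCopy i ∘ w) (inCopy? i ∘ w) K (k , start)
                                    (y∉Hⁱ ∘ subst (InCopy i) end)
    ... | t , t<K , wt∈Hⁱ , wt+1∉Hⁱ =
      trans (sym (toll-neighbourˡ C tw t<K (subst (Adj C (inj₂ (i , k))) (sym exit) refl))) exit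
      where
      exit : w (suc t) ≡ inj₁ i
      exit = exit-copy wt∈Hⁱ wt+1∉Hⁱ (steps t t<K)

  module _ {j : Fin n} {l : Fin m} {x : CVertex n m} {K : ℕ} {w : ℕ → CVertex n m}
           (tw : IsWeaklyTollWalk C x (inj₂ (j , l)) K w) (x∉Hʲ : ¬ InCopy j x) where
    open IsWalk (IsWeaklyTollWalk.walk tw)

    arrives-via-anchor : w (K ∸ 1) ≡ inj₁ j
    arrives-via-anchor with crossing (λ t → ¬ InCopy j (w t)) (λ t → ¬? (inCopy? j (w t))) K
                                     (x∉Hʲ ∘ subst (InCopy j) start) (λ ¬wK∈Hʲ → ¬wK∈Hʲ (l , end))
    ... | t , t<K , wt∉Hʲ , ¬wt+1∉Hʲ =
      trans (sym (toll-neighbourʳ C tw (<⇒≤ t<K)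
                                        (subst (λ z → Adj C z (inj₂ (j , l))) (sym entry) refl)))
            entry
      where
      entry : w t ≡ inj₁ j
      entry = enter-copy wt∉Hʲ (decidable-stable (inCopy? j (w (suc t))) ¬wt+1∉Hʲ) (steps t t<K)

  module _ {i j : Fin n} (i≢j : i ≢ j) (k l : Fin m) where

    u v : CVertex n m
    u = inj₂ (i , k)
    v = inj₂ (j , l)

    Avoids : CVertex n m → Set
    Avoids x = ¬ (InNH H i k x ⊎ InNH H j l x)

    v∉Hⁱ : ¬ InCopy i v
    v∉Hⁱ (_ , v≡) = i≢j (sym (cong anchor v≡))

    u∉Hʲ : ¬ InCopy j u
    u∉Hʲ (_ , u≡) = i≢j (cong anchor u≡)

    WT⇒avoids : ∀ {x} → WT C u v x → Avoids x
    WT⇒avoids (K , w , tw , s , s≤K , refl) (inj₁ x∈Nᵤ) =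
      neighbour≢anchor x∈Nᵤ
        (trans (toll-neighbourˡ C tw s≤K (neighbour-adj x∈Nᵤ)) (leaves-via-anchor tw v∉Hⁱ))
    WT⇒avoids (K , w , tw , s , s≤K , refl) (inj₂ x∈Nᵥ) =
      neighbour≢anchor x∈Nᵥ
        (trans (toll-neighbourʳ C tw s≤K (symAdj C {v} {w s} (neighbour-adj x∈Nᵥ)))
               (arrives-via-anchor tw u∉Hʲ))

    anchor-avoids : ∀ c → Avoids (inj₁ c)
    anchor-avoids c (inj₁ (_ , () , _))
    anchor-avoids c (inj₂ (_ , () , _))

    u-avoids : Avoids u
    u-avoids (inj₁ (_ , refl , k~k)) = irrefl H k~k
    u-avoids (inj₂ x∈Nᵥ)             = u∉Hʲ (_ , proj₁ (proj₂ x∈Nᵥ))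

    v-avoids : Avoids v
    v-avoids (inj₁ x∈Nᵤ)             = v∉Hⁱ (_ , proj₁ (proj₂ x∈Nᵤ))
    v-avoids (inj₂ (_ , refl , l~l)) = irrefl H l~l

    avoiding-neighbourˡ : ∀ {y} → Avoids y → Adj C u y → y ≡ inj₁ i
    avoiding-neighbourˡ {inj₁ _}       _        i≡c        = cong inj₁ (sym i≡c)
    avoiding-neighbourˡ {inj₂ (_ , a)} y-avoids (refl , k~a) =
      ⊥-elim (y-avoids (inj₁ (a , refl , k~a)))

    avoiding-neighbourʳ : ∀ {y} → Avoids y → Adj C y v → y ≡ inj₁ j
    avoiding-neighbourʳ {inj₁ _}       _        c≡j        = cong inj₁ c≡j
    avoiding-neighbourʳ {inj₂ (_ , a)} y-avoids (refl , a~l) =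
      ⊥-elim (y-avoids (inj₂ (a , refl , symAdj H a~l)))

    open Walks C Avoids

    detour : ∀ x → Avoids x → Walk (inj₁ (anchor x)) (inj₁ (anchor x))
    detour (inj₁ c)       _        = [ anchor-avoids c ]
    detour (inj₂ (c , _)) x-avoids =
      anchor-avoids c ∷⟨ refl ⟩ x-avoids ∷⟨ refl ⟩ [ anchor-avoids c ]

    detour-visits : ∀ x (x-avoids : Avoids x) → Visits (detour x x-avoids) x
    detour-visits (inj₁ _) _ = 0 , z≤n , refl
    detour-visits (inj₂ _) _ = 1 , s≤s z≤n , refl

    lift : Connected G → ∀ a b → Walk (inj₁ a) (inj₁ b)
    lift conn a b = map-isWalk G inj₁ (λ e → e) anchor-avoids _ (proj₂ (proj₂ (conn a b)))

    avoids⇒WT : Connected G → ∀ {x} → Avoids x → WT C u v x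
    avoids⇒WT conn {x} x-avoids =
      length enclose , at enclose , enclose-weaklyToll , enclose-visits through-x-visits
      where
      through-x : Walk (inj₁ i) (inj₁ j)
      through-x = lift conn i (anchor x) ++ detour x x-avoids ++ lift conn (anchor x) j

      through-x-visits : Visits through-x x
      through-x-visits = visits-++ʳ (lift conn i (anchor x)) _
                           (visits-++ˡ (detour x x-avoids) _ (detour-visits x x-avoids))

      open Enclose avoiding-neighbourˡ avoiding-neighbourʳ u-avoids refl through-x refl v-avoids

mainTheorem14 : (n m : ℕ) → 2 ≤ n → 2 ≤ m →
    (G : Graph (Fin n)) → (H : Graph (Fin m)) →
    Connected G → Connected H → NonComplete G → NonComplete H →
    (i j : Fin n) → i ≢ j → (k l : Fin m) → (x : CVertex n m) →
    WT (corona G H) (inj₂ (i , k)) (inj₂ (j , l)) x ⇔ (¬ (InNH H i k x ⊎ InNH H j l x))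
mainTheorem14 n m _ _ G H G-connected _ _ _ i j i≢j k l x =
  mk⇔ (WT⇒avoids i≢j k l) (avoids⇒WT i≢j k l G-connected)
  where open Corona G H
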